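{- Let $d\ge1$, $k\ge2$, $h\ge2$ be integers. There exist a constant $c=c(d,k,h)>0$ and $n_0$ such that for all $n\ge n_0$ and every point $v\in[n]^d$ all of whose coordinates are either $1$ or $n$, $$f_{[n]^d}(v)\ge c\, n^{dk(h-1)}.$$
   Context: $[n]^d$ is the set of vectors in $\mathbb{Z}^d$ with all coordinates in $\{1,\dots,n\}$, with coordinatewise addition. For $A\subseteq[n]^d$ and $v\in A$, $f_A(v)$ is the number of distinct subsets $\{x_{1,i}:2\le i\le h\}\cup\{x_{\ell,i}:2\le\ell\le k,1\le i\le h\}$ of $A\setminus\{v\}$ consisting of $kh-1$ pairwise distinct points such that $v+\sum_{i=2}^h x_{1,i}=\sum_{i=1}^h x_{2,i}=\cdots=\sum_{i=1}^h x_{k,i}$. -}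

module Defs where

open import Data.Nat using (ℕ; zero; suc; _+_; _*_; _∸_)
open import Data.Bool using (Bool; true; false; _∧_; not)
open import Data.List as L using (List; []; _∷_; _++_; map; concatMap; filterᵇ; length; take; drop; applyUpTo; foldr)
open import Data.Bool.ListAction using (all; any)
open import Data.Vec as V using (Vec; zipWith; replicate)
import Data.Vec.Properties as VP
open import Data.Nat.Properties using () renaming (_≟_ to _≟ℕ_)
open import Relation.Nullary.Decidable using (⌊_⌋; ¬?)

-- Points of ℤ^d with nonnegative coordinates (enough for [n]^d).
Point : ℕ → Set
Point d = Vec ℕ d

_⊕_ : ∀ {d} → Point d → Point d → Point d
_⊕_ = zipWith _+_

vsum : ∀ {d} → List (Point d) → Point d
vsum {d} = foldr _⊕_ (replicate d 0)

_==_ : ∀ {d} → Point d → Point d → Bool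
x == y = ⌊ VP.≡-dec _≟ℕ_ x y ⌋

-- [n]^d as a duplicate-free list: all vectors with coordinates in {1,…,n}
box : ℕ → (d : ℕ) → List (Point d)
box n zero = V.[] ∷ []
box n (suc d) = concatMap (λ a → map (a V.∷_) (box n d)) (applyUpTo suc n)

-- all sublists (each subset of a duplicate-free list appears exactly once)
sublists : ∀ {a} {A : Set a} → List A → List (List A)
sublists [] = [] ∷ []
sublists (x ∷ xs) = map (x ∷_) (sublists xs) ++ sublists xs

inserts : ∀ {a} {A : Set a} → A → List A → List (List A)
inserts x [] = (x ∷ []) ∷ []
inserts x (y ∷ ys) = (x ∷ y ∷ ys) ∷ map (y ∷_) (inserts x ys)

perms : ∀ {a} {A : Set a} → List A → List (List A)
perms [] = [] ∷ []
perms (x ∷ xs) = concatMap (inserts x) (perms xs)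

blocks : ∀ {a} {A : Set a} → ℕ → ℕ → List A → List (List A)
blocks zero s xs = []
blocks (suc m) s xs = take s xs ∷ blocks m s (drop s xs)

-- An ordering L = (x_{1,2},…,x_{1,h}, x_{2,1},…,x_{2,h}, …, x_{k,1},…,x_{k,h})
-- of kh-1 points satisfies v + Σ_{i≥2} x_{1,i} = Σ_i x_{2,i} = ⋯ = Σ_i x_{k,i}.
arrangementOK : ∀ {d} → ℕ → ℕ → Point d → List (Point d) → Bool
arrangementOK k h v L =
  all (λ B → vsum B == (v ⊕ vsum (take (h ∸ 1) L)))
      (blocks (k ∸ 1) h (drop (h ∸ 1) L))

admissible : ∀ {d} → ℕ → ℕ → Point d → List (Point d) → Bool
admissible k h v S =
  ⌊ length S ≟ℕ (k * h ∸ 1) ⌋ ∧ any (arrangementOK k h v) (perms S)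

-- f_A(v) for A given as a duplicate-free list: number of subsets of A ∖ {v}
-- consisting of kh-1 distinct points admitting such a labelling.
f : ∀ {d} → ℕ → ℕ → List (Point d) → Point d → ℕ
f k h A v = length (filterᵇ (λ S → admissible k h v S)
                           (sublists (filterᵇ (λ x → not (x == v)) A)))

-- Write k = K + 1 and h = H + 1. Each coordinate is handled on its own by a one-dimensional gadget
-- depending on parameters t₀, …, t_{R-1} ∈ [0, M], R = kH: the free values X + qG + t_q (G = M + 1)
-- lie in disjoint windows and are cut into k consecutive blocks of H values with increasing sums
-- B₀ < ⋯ < B_K. Block K is placed next to v, and every other block u is completed by the single
-- connector value 1 + B_K − B_u, which lies in [2, X); so all k − 1 groups balance v plus block K.
-- If the coordinate of v is n rather than 1, the reflection x ↦ n + 1 − x is applied. The kh − 1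
-- resulting points have distinct first coordinates and lie strictly inside [n]^d, so they form an
-- admissible set avoiding v, from which t can be read back. This gives (M + 1)^{dR} admissible sets,
-- and M + 1 ≈ n / scale yields the bound, since dR = dk(h − 1).

module Submission where

open import Defs
open import Data.Nat using (ℕ; zero; suc; pred; _+_; _*_; _∸_; _^_; _≤_; _<_; z≤n; s≤s; NonZero; >-nonZero)
open import Data.Nat.Properties
open import Data.Nat.DivMod using (_/_; _%_; m/n*n≤m; m≡m%n+[m/n]*n; m%n<n; m≥n⇒m/n>0)
open import Data.Nat.ListAction using (sum)
open import Data.Nat.Solver using (module +-*-Solver)
open import Algebra.Properties.CommutativeSemigroup +-commutativeSemigroup using (interchange)
open import Data.List using (List; []; _∷_; _++_; map; concat; concatMap; length; reverse; take; drop; filterᵇ; applyUpTo; cartesianProductWith)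
open import Data.List.Properties using (length-++; length-map; length-reverse; unfold-reverse; map-++; map-∘; map-cong; map-concatMap; reverse-map; ++-assoc; ∷-injectiveˡ; ∷-injectiveʳ; filter-all)
open import Data.List.Membership.Propositional using (_∈_; lose)
open import Data.List.Membership.Propositional.Properties using (∈-∃++; ∈-++⁺ˡ; ∈-++⁺ʳ; ∈-map⁺; ∈-concat⁺′; ∈-filter⁺; ∈-applyUpTo⁺)
open import Data.List.Relation.Unary.Any using (here; there)
import Data.List.Relation.Unary.Any.Properties as Any
open import Data.List.Relation.Unary.All as All using (All; []; _∷_)
import Data.List.Relation.Unary.All.Properties as All
open import Data.List.Relation.Unary.AllPairs as AllPairs using (AllPairs; []; _∷_)
import Data.List.Relation.Unary.AllPairs.Properties as AllPairs
open import Data.List.Relation.Unary.Unique.Propositional using (Unique)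
import Data.List.Relation.Unary.Unique.Propositional.Properties as Unique
open import Data.List.Relation.Binary.Permutation.Propositional using (_↭_; ↭-refl; ↭-sym; ↭-trans; ↭-reflexive; prep; module PermutationReasoning)
import Data.List.Relation.Binary.Permutation.Propositional.Properties as Perm
open import Data.List.Relation.Binary.Sublist.Propositional using (_⊆_; []; _∷_; _∷ʳ_; minimum; from∈)
import Data.List.Relation.Binary.Sublist.Propositional.Properties as Sublist
open import Data.Vec as Vec using (Vec; []; _∷_; lookup; tabulate)
import Data.Vec.Properties as Vec
open import Data.Vec.Relation.Unary.All as VecAll using ([]; _∷_)
import Data.Vec.Relation.Unary.All.Properties as VecAll
open import Data.Fin as Fin using (Fin)
open import Data.Bool using (T; not)
open import Data.Bool.Properties using (T-∧)
open import Data.Sum using (_⊎_; inj₁; inj₂; [_,_]′)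
open import Data.Product using (Σ; _×_; _,_; proj₁; proj₂; uncurry)
open import Data.Empty using (⊥-elim)
open import Function using (_∘_; id; const; flip; _on_; Equivalence)
open import Relation.Nullary using (¬_; yes; no)
open import Relation.Nullary.Decidable using (fromWitness; fromWitnessFalse; T?)
open import Relation.Binary.PropositionalEquality
open +-*-Solver using (solve; _:+_; _:*_; _:=_; con)

range : ℕ → ℕ → List ℕ
range a zero = []
range a (suc n) = a ∷ range (suc a) n

length-range : ∀ a n → length (range a n) ≡ n
length-range a zero = refl
length-range a (suc n) = cong suc (length-range (suc a) n)

range-bounds : ∀ a n → All (λ i → a ≤ i × i < a + n) (range a n)
range-bounds a zero = []
range-bounds a (suc n) = (≤-refl , m<m+n a (s≤s z≤n))
  ∷ All.map (λ { {i} (a<i , i<) → <⇒≤ a<i , subst (i <_) (sym (+-suc a n)) i< }) (range-bounds (suc a) n)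

range-sorted : ∀ a n → AllPairs _<_ (range a n)
range-sorted a zero = []
range-sorted a (suc n) = All.map proj₁ (range-bounds (suc a) n) ∷ range-sorted (suc a) n

∈-range : ∀ a n {q} → a ≤ q → q < a + n → q ∈ range a n
∈-range a zero a≤q q<a+0 = ⊥-elim (<-irrefl refl (≤-<-trans a≤q (subst (_ <_) (+-identityʳ a) q<a+0)))
∈-range a (suc n) {q} a≤q q<a+n with a ≟ q
... | yes refl = here refl
... | no a≢q = there (∈-range (suc a) n (≤∧≢⇒< a≤q a≢q) (subst (q <_) (+-suc a n) q<a+n))

range-++ : ∀ a m k → range a (m + k) ≡ range a m ++ range (a + m) k
range-++ a zero k = cong (λ b → range b k) (sym (+-identityʳ a))
range-++ a (suc m) k = cong (a ∷_) (trans (range-++ (suc a) m k) (cong (λ b → range (suc a) m ++ range b k) (sym (+-suc a m))))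

Unique⇒length≤ : ∀ {A : Set} {xs ys : List A} → Unique xs → All (_∈ ys) xs → length xs ≤ length ys
Unique⇒length≤ [] [] = z≤n
Unique⇒length≤ {xs = x ∷ xs} (x∉xs ∷ uniq) (x∈ys ∷ xs⊆ys) with ∈-∃++ x∈ys
... | us , ws , refl = begin
    suc (length xs)            ≤⟨ s≤s (Unique⇒length≤ uniq (All.zipWith (λ (x≢ , y∈) → remove us (x≢ ∘ sym) y∈) (x∉xs , xs⊆ys))) ⟩
    suc (length (us ++ ws))    ≡⟨ cong suc (length-++ us) ⟩
    suc (length us + length ws) ≡⟨ sym (+-suc (length us) (length ws)) ⟩
    length us + length (x ∷ ws) ≡⟨ sym (length-++ us) ⟩
    length (us ++ x ∷ ws)      ∎
  where
  open ≤-Reasoning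
  remove : ∀ {y} us {ws} → ¬ y ≡ x → y ∈ us ++ x ∷ ws → y ∈ us ++ ws
  remove [] y≢x (here y≡x) = ⊥-elim (y≢x y≡x)
  remove [] y≢x (there y∈) = y∈
  remove (u ∷ us) y≢x (here y≡u) = here y≡u
  remove (u ∷ us) y≢x (there y∈) = there (remove us y≢x y∈)

AllPairs-reverse⁺ : ∀ {A : Set} {R : A → A → Set} {xs : List A} → AllPairs R xs → AllPairs (flip R) (reverse xs)
AllPairs-reverse⁺ {xs = []} [] = []
AllPairs-reverse⁺ {xs = x ∷ xs} (Rx ∷ Rxs) rewrite unfold-reverse x xs =
  AllPairs.++⁺ (AllPairs-reverse⁺ Rxs) ([] ∷ []) (Perm.All-resp-↭ (↭-sym (Perm.↭-reverse xs)) (All.map (_∷ []) Rx))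

AllPairs-map-on : ∀ {A : Set} {P : A → Set} {Q R : A → A → Set} {xs : List A} →
  (∀ {x y} → P x → P y → Q x y → R x y) → All P xs → AllPairs Q xs → AllPairs R xs
AllPairs-map-on Q⇒R [] [] = []
AllPairs-map-on Q⇒R (Px ∷ Pxs) (Qx ∷ Qxs) =
  All.zipWith (λ (Qxy , Py) → Q⇒R Px Py Qxy) (Qx , Pxs) ∷ AllPairs-map-on Q⇒R Pxs Qxs

map-cong-local⁻ : ∀ {A B : Set} {f g : A → B} {xs : List A} → map f xs ≡ map g xs → All (λ x → f x ≡ g x) xs
map-cong-local⁻ {xs = []} _ = []
map-cong-local⁻ {xs = _ ∷ _} eq = ∷-injectiveˡ eq ∷ map-cong-local⁻ (∷-injectiveʳ eq)

sum-map-≥ : ∀ {A : Set} (f : A → ℕ) {c} {xs : List A} → All (λ x → c ≤ f x) xs → length xs * c ≤ sum (map f xs)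
sum-map-≥ f [] = z≤n
sum-map-≥ f (c≤fx ∷ c≤fxs) = +-mono-≤ c≤fx (sum-map-≥ f c≤fxs)

sum-map-≤ : ∀ {A : Set} (f : A → ℕ) {c} {xs : List A} → All (λ x → f x ≤ c) xs → sum (map f xs) ≤ length xs * c
sum-map-≤ f [] = z≤n
sum-map-≤ f (fx≤c ∷ fxs≤c) = +-mono-≤ fx≤c (sum-map-≤ f fxs≤c)

sum-map-∸ : ∀ {N} {xs : List ℕ} → All (_≤ N) xs → sum (map (N ∸_) xs) + sum xs ≡ length xs * N
sum-map-∸ [] = refl
sum-map-∸ {N} {x ∷ xs} (x≤N ∷ xs≤N) = begin
  (N ∸ x + sum (map (N ∸_) xs)) + (x + sum xs) ≡⟨ interchange (N ∸ x) _ x _ ⟩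
  (N ∸ x + x) + (sum (map (N ∸_) xs) + sum xs) ≡⟨ cong₂ _+_ (m∸n+n≡m x≤N) (sum-map-∸ xs≤N) ⟩
  N + length xs * N                            ∎
  where open ≡-Reasoning

sum-map-∸-cong : ∀ {N} {xs ys : List ℕ} → All (_≤ N) xs → All (_≤ N) ys → length xs ≡ length ys →
  sum xs ≡ sum ys → sum (map (N ∸_) xs) ≡ sum (map (N ∸_) ys)
sum-map-∸-cong {N} {xs} {ys} xs≤N ys≤N |xs|≡|ys| Σxs≡Σys = +-cancelʳ-≡ (sum xs) _ _ (begin
  sum (map (N ∸_) xs) + sum xs ≡⟨ sum-map-∸ xs≤N ⟩
  length xs * N                ≡⟨ cong (_* N) |xs|≡|ys| ⟩
  length ys * N                ≡⟨ sym (sum-map-∸ ys≤N) ⟩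
  sum (map (N ∸_) ys) + sum ys ≡⟨ cong (sum (map (N ∸_) ys) +_) (sym Σxs≡Σys) ⟩
  sum (map (N ∸_) ys) + sum xs ∎)
  where open ≡-Reasoning

module _ (f : ℕ → ℕ) (f-mono : ∀ {i j} → i < j → f i < f j) where

  sum-range-mono-≤ : ∀ n {a b} → a ≤ b → sum (map f (range a n)) ≤ sum (map f (range b n))
  sum-range-mono-≤ zero a≤b = z≤n
  sum-range-mono-≤ (suc n) a≤b with m≤n⇒m<n∨m≡n a≤b
  ... | inj₁ a<b = +-mono-≤ (<⇒≤ (f-mono a<b)) (sum-range-mono-≤ n (s≤s a≤b))
  ... | inj₂ refl = ≤-refl

  sum-range-mono-< : ∀ n {a b} → a < b → sum (map f (range a (suc n))) < sum (map f (range b (suc n)))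
  sum-range-mono-< n a<b = +-mono-<-≤ (f-mono a<b) (sum-range-mono-≤ n (s≤s (<⇒≤ a<b)))

split-concatMap-∷ : ∀ {A B : Set} (g : A → B) (h : A → List B) (us : List A) →
  concatMap (λ u → g u ∷ h u) us ↭ map g us ++ concatMap h us
split-concatMap-∷ g h [] = ↭-reflexive refl
split-concatMap-∷ g h (u ∷ us) = prep (g u) (↭-trans (Perm.++⁺ˡ (h u) (split-concatMap-∷ g h us)) (Perm.shifts (h u) (map g us)))

vectors : ∀ {A : Set} k → List A → List (Vec A k)
vectors zero xs = [] ∷ []
vectors (suc k) xs = cartesianProductWith Vec._∷_ xs (vectors k xs)

length-cartesianProductWith : ∀ {A B C : Set} (f : A → B → C) xs ys →
  length (cartesianProductWith f xs ys) ≡ length xs * length ys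
length-cartesianProductWith f [] ys = refl
length-cartesianProductWith f (x ∷ xs) ys =
  trans (length-++ (map (f x) ys)) (cong₂ _+_ (length-map (f x) ys) (length-cartesianProductWith f xs ys))

length-vectors : ∀ {A : Set} k (xs : List A) → length (vectors k xs) ≡ length xs ^ k
length-vectors zero xs = refl
length-vectors (suc k) xs =
  trans (length-cartesianProductWith Vec._∷_ xs (vectors k xs)) (cong (length xs *_) (length-vectors k xs))

vectors-All : ∀ {A : Set} {P : A → Set} k {xs : List A} → All P xs → All (VecAll.All P) (vectors k xs)
vectors-All zero Pxs = [] ∷ []
vectors-All {A} (suc k) {xs} Pxs = All.cartesianProductWith⁺ (setoid A) (setoid (Vec A k)) Vec._∷_ xs (vectors k xs)
  λ x∈ w∈ → All.lookup Pxs x∈ ∷ All.lookup (vectors-All k Pxs) w∈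

vectors-Unique : ∀ {A : Set} k {xs : List A} → Unique xs → Unique (vectors k xs)
vectors-Unique zero Uxs = [] ∷ []
vectors-Unique (suc k) Uxs = Unique.cartesianProductWith⁺ Vec._∷_ Vec.∷-injective Uxs (vectors-Unique k Uxs)

-- Entry q of a vector, with junk value 0 past its end.
at : ∀ {r} → Vec ℕ r → ℕ → ℕ
at [] _ = 0
at (x ∷ xs) zero = x
at (x ∷ xs) (suc q) = at xs q

at-≤ : ∀ {M r} {w : Vec ℕ r} → VecAll.All (_≤ M) w → ∀ q → at w q ≤ M
at-≤ [] q = z≤n
at-≤ (x≤M ∷ _) zero = x≤M
at-≤ (_ ∷ w≤M) (suc q) = at-≤ w≤M q

at-ext : ∀ {r} {w w′ : Vec ℕ r} → (∀ {q} → q < r → at w q ≡ at w′ q) → w ≡ w′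
at-ext {w = []} {[]} _ = refl
at-ext {w = x ∷ w} {x′ ∷ w′} w≗w′ = cong₂ _∷_ (w≗w′ (s≤s z≤n)) (at-ext (w≗w′ ∘ s≤s))

≗⇒≡ : ∀ {A : Set} {m} {x y : Vec A m} → (∀ j → lookup x j ≡ lookup y j) → x ≡ y
≗⇒≡ {x = x} {y} x≗y = trans (sym (Vec.tabulate∘lookup x)) (trans (Vec.tabulate-cong x≗y) (Vec.tabulate∘lookup y))

^-distribʳ-* : ∀ a b e → (a * b) ^ e ≡ a ^ e * b ^ e
^-distribʳ-* a b zero = refl
^-distribʳ-* a b (suc e) = trans (cong (a * b *_) (^-distribʳ-* a b e))
  (solve 4 (λ a b x y → (a :* b) :* (x :* y) := (a :* x) :* (b :* y)) refl a b (a ^ e) (b ^ e))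

multiple-sandwich : ∀ n c .{{_ : NonZero c}} → c ≤ n → Σ ℕ λ m → suc m * c ≤ n × n ≤ 2 * c * suc m
multiple-sandwich n c c≤n = pred q , subst (λ m → m * c ≤ n) (sym 1+m≡q) (m/n*n≤m n c) , (begin
  n              ≡⟨ m≡m%n+[m/n]*n n c ⟩
  n % c + q * c  ≤⟨ +-monoˡ-≤ (q * c) (<⇒≤ (m%n<n n c)) ⟩
  c + q * c      ≤⟨ +-monoˡ-≤ (q * c) (m≤n*m c q) ⟩
  q * c + q * c  ≡⟨ solve 2 (λ q c → q :* c :+ q :* c := con 2 :* c :* q) refl q c ⟩
  2 * c * q      ≡⟨ cong (2 * c *_) (sym 1+m≡q) ⟩
  2 * c * suc (pred q) ∎)
  where
  open ≤-Reasoning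
  q : ℕ
  q = n / c
  instance
    q≢0 : NonZero q
    q≢0 = >-nonZero (m≥n⇒m/n>0 c≤n)
  1+m≡q : suc (pred q) ≡ q
  1+m≡q = suc-pred q

lookup-vsum : ∀ {d} (xs : List (Point d)) j → lookup (vsum xs) j ≡ sum (map (λ x → lookup x j) xs)
lookup-vsum [] j = Vec.lookup-replicate j 0
lookup-vsum (x ∷ xs) j = trans (Vec.lookup-zipWith _+_ j x (vsum xs)) (cong (lookup x j +_) (lookup-vsum xs j))

∈-inserts : ∀ {A : Set} (x : A) us ws → us ++ x ∷ ws ∈ inserts x (us ++ ws)
∈-inserts x [] [] = here refl
∈-inserts x [] (w ∷ ws) = here refl
∈-inserts x (u ∷ us) ws = there (∈-map⁺ (u ∷_) (∈-inserts x us ws))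

↭⇒∈-perms : ∀ {A : Set} (S : List A) {L} → L ↭ S → L ∈ perms S
↭⇒∈-perms [] L↭[] rewrite Perm.↭-empty-inv L↭[] = here refl
↭⇒∈-perms (x ∷ S) L↭x∷S with ∈-∃++ (Perm.∈-resp-↭ (↭-sym L↭x∷S) (here refl))
... | us , ws , refl = ∈-concat⁺′ (∈-inserts x us ws) (∈-map⁺ (inserts x) (↭⇒∈-perms S (Perm.drop-mid us [] L↭x∷S)))

⊆⇒∈-sublists : ∀ {A : Set} {xs ys : List A} → xs ⊆ ys → xs ∈ sublists ys
⊆⇒∈-sublists [] = here refl
⊆⇒∈-sublists (y ∷ʳ xs⊆ys) = ∈-++⁺ʳ _ (⊆⇒∈-sublists xs⊆ys)
⊆⇒∈-sublists {ys = y ∷ _} (refl ∷ xs⊆ys) = ∈-++⁺ˡ (∈-map⁺ (y ∷_) (⊆⇒∈-sublists xs⊆ys))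

module _ {A : Set} where

  take-++-length : ∀ (xs ys : List A) → take (length xs) (xs ++ ys) ≡ xs
  take-++-length [] ys = refl
  take-++-length (x ∷ xs) ys = cong (x ∷_) (take-++-length xs ys)

  drop-++-length : ∀ (xs ys : List A) → drop (length xs) (xs ++ ys) ≡ ys
  drop-++-length [] ys = refl
  drop-++-length (x ∷ xs) ys = drop-++-length xs ys

  blocks-concat : ∀ {s} {Bs : List (List A)} → All (λ B → length B ≡ s) Bs → blocks (length Bs) s (concat Bs) ≡ Bs
  blocks-concat [] = refl
  blocks-concat {Bs = B ∷ Bs} (refl ∷ |Bs|≡s) =
    cong₂ _∷_ (take-++-length B _) (trans (cong (blocks (length Bs) _) (drop-++-length B _)) (blocks-concat |Bs|≡s))

module _ {d} (k h : ℕ) (v : Point d) where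

  arrangementOK-intro : ∀ (A : List (Point d)) (Bs : List (List (Point d))) →
    length A ≡ h ∸ 1 → length Bs ≡ k ∸ 1 → All (λ B → length B ≡ h) Bs →
    All (λ B → vsum B ≡ v ⊕ vsum A) Bs → T (arrangementOK k h v (A ++ concat Bs))
  arrangementOK-intro A Bs |A| |Bs| |Bs|≡h balanced
    rewrite sym |A| | sym |Bs| | take-++-length A (concat Bs) | drop-++-length A (concat Bs) | blocks-concat |Bs|≡h
    = All.all⁻ _ (All.map fromWitness balanced)

  admissible-intro : ∀ {S L : List (Point d)} → length S ≡ k * h ∸ 1 → L ↭ S →
    T (arrangementOK k h v L) → T (admissible k h v S)
  admissible-intro |S| L↭S L-ok =
    Equivalence.from T-∧ (fromWitness |S| , Any.any⁺ _ (lose (↭⇒∈-perms _ L↭S) L-ok))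

  length≤f : ∀ {Tuple : Set} {Good : Tuple → Set} (S : Tuple → List (Point d)) (A : List (Point d)) {ts : List Tuple} →
    Unique ts → All Good ts →
    (∀ {t t′} → Good t → Good t′ → S t ≡ S t′ → t ≡ t′) →
    (∀ {t} → Good t → S t ⊆ filterᵇ (λ x → not (x == v)) A) →
    (∀ {t} → Good t → T (admissible k h v (S t))) →
    length ts ≤ f k h A v
  length≤f S A {ts} unique good injective S⊆ S-admissible = begin
    length ts         ≡⟨ sym (length-map S ts) ⟩
    length (map S ts) ≤⟨ Unique⇒length≤
      (AllPairs.map⁺ (AllPairs-map-on (λ gt gt′ t≢t′ → t≢t′ ∘ injective gt gt′) good unique))
      (All.map⁺ (All.map (λ gt → ∈-filter⁺ (T? ∘ admissible k h v) (⊆⇒∈-sublists (S⊆ gt)) (S-admissible gt)) good)) ⟩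
    f k h A v         ∎
    where open ≤-Reasoning

InBox : ℕ → ∀ {d} → Point d → Set
InBox n x = ∀ j → 1 ≤ lookup x j × lookup x j ≤ n

∈-applyUpTo-suc : ∀ {a n} → 1 ≤ a → a ≤ n → a ∈ applyUpTo suc n
∈-applyUpTo-suc (s≤s z≤n) a≤n = ∈-applyUpTo⁺ suc a≤n

∈-box : ∀ n d {x : Point d} → InBox n x → x ∈ box n d
∈-box n zero {[]} _ = here refl
∈-box n (suc d) {a ∷ y} x∈ =
  ∈-concat⁺′ (∈-map⁺ (a ∷_) (∈-box n d (x∈ ∘ Fin.suc))) (∈-map⁺ _ (uncurry ∈-applyUpTo-suc (x∈ Fin.zero)))

∈-tail-< : ∀ {a b : ℕ} {as} → b ∈ a ∷ as → a < b → b ∈ as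
∈-tail-< (here refl) a<a = ⊥-elim (<-irrefl refl a<a)
∈-tail-< (there b∈) _ = b∈

∈-tail-≢ : ∀ {a b : ℕ} {as} → b ∈ a ∷ as → b ≢ a → b ∈ as
∈-tail-≢ (here b≡a) b≢a = ⊥-elim (b≢a b≡a)
∈-tail-≢ (there b∈) _ = b∈

module _ {d} (B : List (Vec ℕ d)) where

  sorted⊆concatMap-∷ : ∀ {as : List ℕ} {xs : List (Vec ℕ (suc d))} → AllPairs _<_ as →
    AllPairs (_<_ on Vec.head) xs → All (λ x → Vec.head x ∈ as × Vec.tail x ∈ B) xs →
    xs ⊆ concatMap (λ a → map (a ∷_) B) as
  sorted⊆concatMap-∷ {[]} {[]} _ _ _ = []
  sorted⊆concatMap-∷ {[]} {_ ∷ _} _ _ ((() , _) ∷ _)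
  sorted⊆concatMap-∷ {a ∷ as} {[]} _ _ _ = minimum _
  sorted⊆concatMap-∷ {a ∷ as} {(b ∷ y) ∷ xs} (a<as ∷ as<) (b<xs ∷ xs<) ((b∈ , y∈) ∷ xs∈) with b ≟ a
  ... | yes refl = Sublist.++⁺ (from∈ (∈-map⁺ (b ∷_) y∈))
    (sorted⊆concatMap-∷ as< xs< (All.zipWith (λ (b<c , c∈ , z∈) → ∈-tail-< c∈ b<c , z∈) (b<xs , xs∈)))
  ... | no b≢a = Sublist.++⁺ˡ (map (a ∷_) B) (sorted⊆concatMap-∷ as< (b<xs ∷ xs<)
    ((b∈as , y∈) ∷ All.zipWith (λ (b<c , c∈ , z∈) → ∈-tail-< c∈ (<-trans a<b b<c) , z∈) (b<xs , xs∈)))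
    where
    b∈as : b ∈ as
    b∈as = ∈-tail-≢ b∈ b≢a
    a<b : a < b
    a<b = All.lookup a<as b∈as

⊆-box : ∀ n d {xs : List (Point (suc d))} → AllPairs (_<_ on Vec.head) xs → All (InBox n) xs → xs ⊆ box n (suc d)
⊆-box n d xs< xs∈ = sorted⊆concatMap-∷ (box n d) (AllPairs.applyUpTo⁺₁ suc n (λ i<j _ → s≤s i<j)) xs<
  (All.map (λ {x} → head-tail-∈ {x}) xs∈)
  where
  head-tail-∈ : ∀ {x} → InBox n x → Vec.head x ∈ applyUpTo suc n × Vec.tail x ∈ box n d
  head-tail-∈ {a ∷ y} x∈ = uncurry ∈-applyUpTo-suc (x∈ Fin.zero) , ∈-box n d (x∈ ∘ Fin.suc)

-- One coordinate

data Role : Set where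
  connector : ℕ → Role
  free : ℕ → Role

module Roles (K H : ℕ) where

  R : ℕ
  R = suc K * H

  scale : ℕ
  scale = suc H * suc R + 3

  blockRoles : ℕ → List Role
  blockRoles u = map free (range (u * H) H)

  length-blockRoles : ∀ u → length (blockRoles u) ≡ H
  length-blockRoles u = trans (length-map free (range (u * H) H)) (length-range (u * H) H)

  groupRoles : ℕ → List Role
  groupRoles u = connector u ∷ blockRoles u

  -- Connector values decrease with u, hence the reversal.
  ascendingRoles : List Role
  ascendingRoles = map connector (reverse (range 0 K)) ++ map free (range 0 R)

  length-ascendingRoles : length ascendingRoles ≡ suc K * suc H ∸ 1
  length-ascendingRoles = begin
    length ascendingRoles                                                   ≡⟨ length-++ (map connector (reverse (range 0 K))) ⟩
    length (map connector (reverse (range 0 K))) + length (map free (range 0 R)) ≡⟨ cong₂ _+_ connectors frees ⟩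
    K + (H + K * H)                                                         ≡⟨ solve 2 (λ K H → K :+ (H :+ K :* H) := H :+ K :* (con 1 :+ H)) refl K H ⟩
    H + K * suc H                                                           ∎
    where
    open ≡-Reasoning
    connectors : length (map connector (reverse (range 0 K))) ≡ K
    connectors = trans (length-map connector (reverse (range 0 K))) (trans (length-reverse (range 0 K)) (length-range 0 K))
    frees : length (map free (range 0 R)) ≡ R
    frees = trans (length-map free (range 0 R)) (length-range 0 R)

  concatMap-blockRoles : ∀ k b → concatMap blockRoles (range b k) ≡ map free (range (b * H) (k * H))
  concatMap-blockRoles zero b = refl
  concatMap-blockRoles (suc k) b = begin
    blockRoles b ++ concatMap blockRoles (range (suc b) k)         ≡⟨ cong (blockRoles b ++_) (concatMap-blockRoles k (suc b)) ⟩
    map free (range (b * H) H) ++ map free (range (suc b * H) (k * H)) ≡⟨ sym (map-++ free (range (b * H) H) _) ⟩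
    map free (range (b * H) H ++ range (suc b * H) (k * H))       ≡⟨ cong (λ a → map free (range (b * H) H ++ range a (k * H))) (+-comm H (b * H)) ⟩
    map free (range (b * H) H ++ range (b * H + H) (k * H))       ≡⟨ cong (map free) (sym (range-++ (b * H) H (k * H))) ⟩
    map free (range (b * H) (suc k * H))                          ∎
    where open ≡-Reasoning

  concatMap-blockRoles-++ : concatMap blockRoles (range 0 K) ++ blockRoles K ≡ map free (range 0 R)
  concatMap-blockRoles-++ = begin
    concatMap blockRoles (range 0 K) ++ blockRoles K         ≡⟨ cong (_++ blockRoles K) (concatMap-blockRoles K 0) ⟩
    map free (range 0 (K * H)) ++ map free (range (K * H) H) ≡⟨ sym (map-++ free (range 0 (K * H)) _) ⟩
    map free (range 0 (K * H) ++ range (K * H) H)            ≡⟨ cong (map free) (sym (range-++ 0 (K * H) H)) ⟩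
    map free (range 0 (K * H + H))                           ≡⟨ cong (λ m → map free (range 0 m)) (+-comm (K * H) H) ⟩
    map free (range 0 R)                                     ∎
    where open ≡-Reasoning

  arrangement↭ascending : blockRoles K ++ concatMap groupRoles (range 0 K) ↭ ascendingRoles
  arrangement↭ascending = begin
    blockRoles K ++ concatMap groupRoles (range 0 K)
      ↭⟨ Perm.++-comm (blockRoles K) _ ⟩
    concatMap groupRoles (range 0 K) ++ blockRoles K
      ↭⟨ Perm.++⁺ʳ (blockRoles K) (split-concatMap-∷ connector blockRoles (range 0 K)) ⟩
    (map connector (range 0 K) ++ concatMap blockRoles (range 0 K)) ++ blockRoles K
      ≡⟨ ++-assoc (map connector (range 0 K)) _ _ ⟩
    map connector (range 0 K) ++ concatMap blockRoles (range 0 K) ++ blockRoles K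
      ≡⟨ cong (map connector (range 0 K) ++_) concatMap-blockRoles-++ ⟩
    map connector (range 0 K) ++ map free (range 0 R)
      ↭⟨ Perm.++⁺ʳ (map free (range 0 R)) (↭-trans (↭-sym (Perm.↭-reverse _)) (↭-reflexive (sym (reverse-map connector (range 0 K))))) ⟩
    ascendingRoles ∎
    where open PermutationReasoning

data Corner : Set where
  low high : Corner

module Gadget (n M K H′ : ℕ) where

  H : ℕ
  H = suc H′

  open Roles K H public

  -- The free value q lies in [X + q G, X + q G + M]; connector values lie below X.
  G X top : ℕ
  G = suc M
  X = 2 + H * (R * G + M)
  top = X + (R * G + M)

  top<scale : top < suc M * scale
  top<scale = ≤-trans (m≤m+n (suc top) (H + 1 + 3 * M)) (≤-reflexive (solve 3
    (λ H R M → (con 1 :+ ((con 2 :+ H :* (R :* (con 1 :+ M) :+ M)) :+ (R :* (con 1 :+ M) :+ M))) :+ (H :+ con 1 :+ con 3 :* M)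
             := (con 1 :+ M) :* ((con 1 :+ H) :* (con 1 :+ R) :+ con 3))
    refl H R M))

  Small : Vec ℕ R → Set
  Small = VecAll.All (_≤ M)

  freeValue : Vec ℕ R → ℕ → ℕ
  freeValue tv q = X + (q * G + at tv q)

  blockSum : Vec ℕ R → ℕ → ℕ
  blockSum tv u = sum (map (freeValue tv) (range (u * H) H))

  value : Vec ℕ R → Role → ℕ
  value tv (connector u) = suc (blockSum tv K) ∸ blockSum tv u
  value tv (free q) = freeValue tv q

  cornerValue : Corner → ℕ
  cornerValue low = 1
  cornerValue high = n

  -- The reflection x ↦ n + 1 − x turns the corner 1 into n and preserves equalities
  -- between sums of equally many terms.
  coordinate : Corner → Vec ℕ R → Role → ℕ
  coordinate low tv r = value tv r
  coordinate high tv r = suc n ∸ value tv r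

  order : Corner → List Role
  order low = ascendingRoles
  order high = reverse ascendingRoles

  order↭ascending : ∀ c → order c ↭ ascendingRoles
  order↭ascending low = ↭-refl
  order↭ascending high = Perm.↭-reverse ascendingRoles

  module _ {tv : Vec ℕ R} (small : Small tv) where

    freeValue-mono : ∀ {q q′} → q < q′ → freeValue tv q < freeValue tv q′
    freeValue-mono {q} {q′} q<q′ = +-monoʳ-< X (begin-strict
      q * G + at tv q  ≤⟨ +-monoʳ-≤ (q * G) (at-≤ small q) ⟩
      q * G + M        <⟨ +-monoʳ-< (q * G) ≤-refl ⟩
      q * G + G        ≡⟨ +-comm (q * G) G ⟩
      suc q * G        ≤⟨ *-monoˡ-≤ G q<q′ ⟩
      q′ * G           ≤⟨ m≤m+n (q′ * G) (at tv q′) ⟩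
      q′ * G + at tv q′ ∎)
      where open ≤-Reasoning

    X≤freeValue : ∀ q → X ≤ freeValue tv q
    X≤freeValue q = m≤m+n X _

    freeValue≤top : ∀ {q} → q ≤ R → freeValue tv q ≤ top
    freeValue≤top {q} q≤R = +-monoʳ-≤ X (+-mono-≤ (*-monoˡ-≤ G q≤R) (at-≤ small q))

    block-≤top : ∀ {u} → u ≤ K → All (λ q → freeValue tv q ≤ top) (range (u * H) H)
    block-≤top {u} u≤K = All.map (λ (_ , q<) → freeValue≤top (<⇒≤ (<-≤-trans q< block-end))) (range-bounds (u * H) H)
      where
      block-end : u * H + H ≤ R
      block-end = ≤-trans (+-monoˡ-≤ H (*-monoˡ-≤ H u≤K)) (≤-reflexive (+-comm (K * H) H))

    H*X≤blockSum : ∀ u → H * X ≤ blockSum tv u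
    H*X≤blockSum u = subst (λ m → m * X ≤ blockSum tv u) (length-range (u * H) H)
      (sum-map-≥ (freeValue tv) (All.universal X≤freeValue (range (u * H) H)))

    blockSum≤H*top : ∀ {u} → u ≤ K → blockSum tv u ≤ H * top
    blockSum≤H*top {u} u≤K = subst (λ m → blockSum tv u ≤ m * top) (length-range (u * H) H)
      (sum-map-≤ (freeValue tv) (block-≤top u≤K))

    blockSum-mono : ∀ {u u′} → u < u′ → blockSum tv u < blockSum tv u′
    blockSum-mono u<u′ = sum-range-mono-< (freeValue tv) freeValue-mono H′ (*-monoˡ-< H u<u′)

    sum-value-blockRoles : ∀ u → sum (map (value tv) (blockRoles u)) ≡ blockSum tv u
    sum-value-blockRoles u = cong sum (sym (map-∘ {g = value tv} {f = free} (range (u * H) H)))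

    connector-balanced : ∀ {u} → u < K → value tv (connector u) + blockSum tv u ≡ suc (blockSum tv K)
    connector-balanced u<K = m∸n+n≡m (m<n⇒m≤1+n (blockSum-mono u<K))

    2≤connector : ∀ {u} → u < K → 2 ≤ value tv (connector u)
    2≤connector {u} u<K = +-cancelʳ-≤ (blockSum tv u) 2 _
      (subst (2 + blockSum tv u ≤_) (sym (connector-balanced u<K)) (s≤s (blockSum-mono u<K)))

    connector<X : ∀ {u} → u < K → value tv (connector u) < X
    connector<X {u} u<K = s≤s (+-cancelʳ-≤ (H * X) _ _ (begin
      value tv (connector u) + H * X        ≤⟨ +-monoʳ-≤ _ (H*X≤blockSum u) ⟩
      value tv (connector u) + blockSum tv u ≡⟨ connector-balanced u<K ⟩
      suc (blockSum tv K)                   ≤⟨ s≤s (blockSum≤H*top ≤-refl) ⟩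
      suc (H * top)                         ≡⟨ cong suc (*-distribˡ-+ H X (R * G + M)) ⟩
      suc (H * X + H * (R * G + M))         ≡⟨ cong suc (+-comm (H * X) _) ⟩
      suc (H * (R * G + M)) + H * X          ∎))
      where open ≤-Reasoning

    connector-antitone : ∀ {u u′} → u < u′ → u′ < K → value tv (connector u′) < value tv (connector u)
    connector-antitone {u} {u′} u<u′ u′<K = +-cancelʳ-< (blockSum tv u′) _ _ (begin-strict
      value tv (connector u′) + blockSum tv u′ ≡⟨ connector-balanced u′<K ⟩
      suc (blockSum tv K)                     ≡⟨ sym (connector-balanced (<-trans u<u′ u′<K)) ⟩
      value tv (connector u) + blockSum tv u  <⟨ +-monoʳ-< _ (blockSum-mono u<u′) ⟩
      value tv (connector u) + blockSum tv u′ ∎)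
      where open ≤-Reasoning

    connectors<K : All (_< K) (reverse (range 0 K))
    connectors<K = Perm.All-resp-↭ (↭-sym (Perm.↭-reverse (range 0 K))) (All.map proj₂ (range-bounds 0 K))

    ascending-sorted : AllPairs (λ r r′ → value tv r < value tv r′) ascendingRoles
    ascending-sorted = AllPairs.++⁺
      (AllPairs.map⁺ (AllPairs-map-on (λ u<K _ u′<u → connector-antitone u′<u u<K) connectors<K (AllPairs-reverse⁺ (range-sorted 0 K))))
      (AllPairs.map⁺ (AllPairs.map freeValue-mono (range-sorted 0 R)))
      (All.map⁺ (All.map (λ u<K → All.map⁺ (All.universal (λ q → <-≤-trans (connector<X u<K) (X≤freeValue q)) _)) connectors<K))

    module _ (fits : top < n) where

      X<n : X < n
      X<n = ≤-<-trans (m≤m+n X _) fits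

      value-bounds : All (λ r → 2 ≤ value tv r × value tv r < n) ascendingRoles
      value-bounds = All.++⁺
        (All.map⁺ (All.map (λ u<K → 2≤connector u<K , <-trans (connector<X u<K) X<n) connectors<K))
        (All.map⁺ (All.map (λ (_ , q<R) → ≤-trans (s≤s (s≤s z≤n)) (X≤freeValue _) , ≤-<-trans (freeValue≤top (<⇒≤ q<R)) fits)
          (range-bounds 0 R)))

      coordinate-bounds : ∀ c → All (λ r → 2 ≤ coordinate c tv r × coordinate c tv r < n) ascendingRoles
      coordinate-bounds low = value-bounds
      coordinate-bounds high = All.map (λ (2≤a , a<n) → m+n≤o⇒m≤o∸n 2 (s≤s a<n) , ∸-monoʳ-< 2≤a (m<n⇒m≤1+n a<n)) value-bounds

      order-sorted : ∀ c → AllPairs (λ r r′ → coordinate c tv r < coordinate c tv r′) (order c)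
      order-sorted low = ascending-sorted
      order-sorted high = AllPairs-reverse⁺
        (AllPairs-map-on (λ _ (_ , b<n) a<b → ∸-monoʳ-< a<b (m<n⇒m≤1+n b<n)) value-bounds ascending-sorted)

      group-balanced : ∀ c {u} → u < K →
        sum (map (coordinate c tv) (groupRoles u)) ≡ cornerValue c + sum (map (coordinate c tv) (blockRoles K))
      group-balanced low {u} u<K = begin
        value tv (connector u) + sum (map (value tv) (blockRoles u)) ≡⟨ cong (value tv (connector u) +_) (sum-value-blockRoles u) ⟩
        value tv (connector u) + blockSum tv u                       ≡⟨ connector-balanced u<K ⟩
        suc (blockSum tv K)                                          ≡⟨ cong suc (sym (sum-value-blockRoles K)) ⟩
        1 + sum (map (value tv) (blockRoles K))                      ∎
        where open ≡-Reasoning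
      group-balanced high {u} u<K = begin
        sum (map (coordinate high tv) (groupRoles u))
          ≡⟨ cong sum (map-∘ {g = suc n ∸_} {f = value tv} (groupRoles u)) ⟩
        sum (map (suc n ∸_) (map (value tv) (groupRoles u)))
          ≡⟨ sum-map-∸-cong group≤ (s≤s z≤n ∷ block≤ ≤-refl) lengths (group-balanced low u<K) ⟩
        n + sum (map (suc n ∸_) (map (value tv) (blockRoles K)))
          ≡⟨ cong (n +_) (cong sum (sym (map-∘ {g = suc n ∸_} {f = value tv} (blockRoles K)))) ⟩
        n + sum (map (coordinate high tv) (blockRoles K))   ∎
        where
        open ≡-Reasoning
        top≤1+n : top ≤ suc n
        top≤1+n = m<n⇒m≤1+n fits
        block≤ : ∀ {w} → w ≤ K → All (_≤ suc n) (map (value tv) (blockRoles w))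
        block≤ w≤K = All.map⁺ (All.map⁺ (All.map (λ q≤top → ≤-trans q≤top top≤1+n) (block-≤top w≤K)))
        group≤ : All (_≤ suc n) (map (value tv) (groupRoles u))
        group≤ = m<n⇒m≤1+n (<-trans (connector<X u<K) X<n) ∷ block≤ (<⇒≤ u<K)
        lengths : length (map (value tv) (groupRoles u)) ≡ length (1 ∷ map (value tv) (blockRoles K))
        lengths = cong suc (trans (length-map _ (blockRoles u))
          (trans (length-blockRoles u) (sym (trans (length-map _ (blockRoles K)) (length-blockRoles K)))))

  freeValue-injective : ∀ tv tv′ q → freeValue tv q ≡ freeValue tv′ q → at tv q ≡ at tv′ q
  freeValue-injective _ _ q eq = +-cancelˡ-≡ (q * G) _ _ (+-cancelˡ-≡ X _ _ eq)

  coordinate-free-injective : ∀ c {tv tv′} → Small tv → Small tv′ → top < n → ∀ {q} → q < R →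
    coordinate c tv (free q) ≡ coordinate c tv′ (free q) → at tv q ≡ at tv′ q
  coordinate-free-injective low {tv} {tv′} _ _ _ {q} _ = freeValue-injective tv tv′ q
  coordinate-free-injective high {tv} {tv′} small small′ fits {q} q<R =
    freeValue-injective tv tv′ q ∘ ∸-cancelˡ-≡ (≤1+n tv small) (≤1+n tv′ small′)
    where
    ≤1+n : ∀ tv → Small tv → freeValue tv q ≤ suc n
    ≤1+n tv small = ≤-trans (freeValue≤top small (<⇒≤ q<R)) (m<n⇒m≤1+n fits)

-- All coordinates

module Assembly (n M K H′ d′ : ℕ) (v : Point (suc d′)) (v-corner : ∀ j → lookup v j ≡ 1 ⊎ lookup v j ≡ n) where

  open Gadget n M K H′

  d : ℕ
  d = suc d′

  corner : Fin d → Corner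
  corner j = [ const low , const high ]′ (v-corner j)

  cornerValue-corner : ∀ j → cornerValue (corner j) ≡ lookup v j
  cornerValue-corner j with v-corner j
  ... | inj₁ v≡1 = sym v≡1
  ... | inj₂ v≡n = sym v≡n

  Tuple : Set
  Tuple = Vec (Vec ℕ R) d

  Good : Tuple → Set
  Good = VecAll.All Small

  point : Tuple → Role → Point d
  point t r = tabulate (λ j → coordinate (corner j) (lookup t j) r)

  lookup-point : ∀ t r j → lookup (point t r) j ≡ coordinate (corner j) (lookup t j) r
  lookup-point t r j = Vec.lookup∘tabulate (λ j → coordinate (corner j) (lookup t j) r) j

  -- Sorted by first coordinate, hence a sublist of the lexicographically ordered box.
  candidate : Tuple → List (Point d)
  candidate t = map (point t) (order (corner Fin.zero))

  lookup-vsum-point : ∀ t rs j → lookup (vsum (map (point t) rs)) j ≡ sum (map (coordinate (corner j) (lookup t j)) rs)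
  lookup-vsum-point t rs j = trans (lookup-vsum (map (point t) rs) j)
    (cong sum (trans (sym (map-∘ rs)) (map-cong (λ r → lookup-point t r j) rs)))

  interior≢corner : ∀ {x j} → 2 ≤ x × x < n → x ≢ lookup v j
  interior≢corner {x} {j} (2≤x , x<n) x≡v with v-corner j
  ... | inj₁ v≡1 = <-irrefl refl (≤-trans 2≤x (≤-reflexive (trans x≡v v≡1)))
  ... | inj₂ v≡n = <-irrefl (trans x≡v v≡n) x<n

  module _ (fits : top < n) where

    point-bounds : ∀ {t} → Good t → ∀ {r} → r ∈ ascendingRoles → ∀ j → 2 ≤ lookup (point t r) j × lookup (point t r) j < n
    point-bounds {t} good {r} r∈ j = subst (λ x → 2 ≤ x × x < n) (sym (lookup-point t r j)) (
      All.lookup (coordinate-bounds (VecAll.lookup⁺ good j) fits (corner j)) r∈)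

    point-InBox : ∀ {t} → Good t → ∀ {r} → r ∈ ascendingRoles → InBox n (point t r)
    point-InBox good r∈ j = let (2≤x , x<n) = point-bounds good r∈ j in <⇒≤ 2≤x , <⇒≤ x<n

    point≢v : ∀ {t} → Good t → ∀ {r} → r ∈ ascendingRoles → point t r ≢ v
    point≢v good r∈ p≡v = interior≢corner (point-bounds good r∈ Fin.zero) (cong (λ x → lookup x Fin.zero) p≡v)

    candidate-⊆ : ∀ {t} → Good t → candidate t ⊆ filterᵇ (λ x → not (x == v)) (box n d)
    candidate-⊆ {t} good = subst (_⊆ _) (filter-all (T? ∘ (λ x → not (x == v))) candidate≢v)
      (Sublist.filter⁺ (T? ∘ _) (T? ∘ _) (λ { refl → id }) candidate⊆box)
      where
      ∈order : ∀ {r} → r ∈ order (corner Fin.zero) → r ∈ ascendingRoles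
      ∈order = Perm.∈-resp-↭ (order↭ascending (corner Fin.zero))
      sorted : AllPairs (_<_ on Vec.head) (candidate t)
      sorted = AllPairs.map⁺ (order-sorted (VecAll.lookup⁺ good Fin.zero) fits (corner Fin.zero))
      candidate⊆box : candidate t ⊆ box n d
      candidate⊆box = ⊆-box n d′ sorted (All.map⁺ (All.tabulate (point-InBox good ∘ ∈order)))
      candidate≢v : All (λ x → T (not (x == v))) (candidate t)
      candidate≢v = All.map⁺ (All.tabulate (λ r∈ → fromWitnessFalse (point≢v good (∈order r∈))))

    arrangement : Tuple → List (Point d)
    arrangement t = map (point t) (blockRoles K) ++ concat (map (map (point t) ∘ groupRoles) (range 0 K))

    arrangement↭candidate : ∀ t → arrangement t ↭ candidate t
    arrangement↭candidate t = subst (_↭ candidate t) unfold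
      (Perm.map⁺ (point t) (↭-trans arrangement↭ascending (↭-sym (order↭ascending (corner Fin.zero)))))
      where
      unfold : map (point t) (blockRoles K ++ concatMap groupRoles (range 0 K)) ≡ arrangement t
      unfold = trans (map-++ (point t) (blockRoles K) _)
        (cong (map (point t) (blockRoles K) ++_) (map-concatMap (point t) groupRoles (range 0 K)))

    group-vsum : ∀ {t} → Good t → ∀ {u} → u < K → vsum (map (point t) (groupRoles u)) ≡ v ⊕ vsum (map (point t) (blockRoles K))
    group-vsum {t} good {u} u<K = ≗⇒≡ λ j → begin
      lookup (vsum (map (point t) (groupRoles u))) j                      ≡⟨ lookup-vsum-point t (groupRoles u) j ⟩
      sum (map (coordinate (corner j) (lookup t j)) (groupRoles u))       ≡⟨ group-balanced (VecAll.lookup⁺ good j) fits (corner j) u<K ⟩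
      cornerValue (corner j) + sum (map (coordinate (corner j) (lookup t j)) (blockRoles K))
        ≡⟨ cong₂ _+_ (cornerValue-corner j) (sym (lookup-vsum-point t (blockRoles K) j)) ⟩
      lookup v j + lookup (vsum (map (point t) (blockRoles K))) j         ≡⟨ sym (Vec.lookup-zipWith _+_ j v _) ⟩
      lookup (v ⊕ vsum (map (point t) (blockRoles K))) j                  ∎
      where open ≡-Reasoning

    candidate-admissible : ∀ {t} → Good t → T (admissible (suc K) (suc H) v (candidate t))
    candidate-admissible {t} good = admissible-intro (suc K) (suc H) v length-candidate (arrangement↭candidate t)
      (arrangementOK-intro (suc K) (suc H) v _ _
        (trans (length-map (point t) (blockRoles K)) (length-blockRoles K))
        (trans (length-map _ (range 0 K)) (length-range 0 K))
        (All.map⁺ (All.universal (λ u → trans (length-map (point t) (groupRoles u)) (cong suc (length-blockRoles u))) _))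
        (All.map⁺ (All.map (λ (_ , u<K) → group-vsum good u<K) (range-bounds 0 K))))
      where
      length-candidate : length (candidate t) ≡ suc K * suc H ∸ 1
      length-candidate = trans (length-map (point t) (order (corner Fin.zero)))
        (trans (Perm.↭-length (order↭ascending (corner Fin.zero))) length-ascendingRoles)

    candidate-injective : ∀ {t t′} → Good t → Good t′ → candidate t ≡ candidate t′ → t ≡ t′
    candidate-injective {t} {t′} good good′ eq = ≗⇒≡ λ j → at-ext λ q<R →
      coordinate-free-injective (corner j) (VecAll.lookup⁺ good j) (VecAll.lookup⁺ good′ j) fits q<R (begin
        coordinate (corner j) (lookup t j) (free _)  ≡⟨ sym (lookup-point t (free _) j) ⟩
        lookup (point t (free _)) j                  ≡⟨ cong (λ x → lookup x j) (All.lookup (map-cong-local⁻ eq) (free∈order q<R)) ⟩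
        lookup (point t′ (free _)) j                 ≡⟨ lookup-point t′ (free _) j ⟩
        coordinate (corner j) (lookup t′ j) (free _) ∎)
      where
      open ≡-Reasoning
      free∈order : ∀ {q} → q < R → free q ∈ order (corner Fin.zero)
      free∈order q<R = Perm.∈-resp-↭ (↭-sym (order↭ascending (corner Fin.zero)))
        (∈-++⁺ʳ _ (∈-map⁺ free (∈-range 0 R z≤n q<R)))

    parameters : List Tuple
    parameters = vectors d (vectors R (range 0 (suc M)))

    candidates-count : (suc M ^ R) ^ d ≤ f (suc K) (suc H) (box n d) v
    candidates-count = subst (_≤ f (suc K) (suc H) (box n d) v) length-parameters
      (length≤f (suc K) (suc H) v candidate (box n d)
        (vectors-Unique d (vectors-Unique R (AllPairs.map <⇒≢ (range-sorted 0 (suc M)))))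
        (vectors-All d (vectors-All R (All.map (λ (_ , i<1+M) → ≤-pred i<1+M) (range-bounds 0 (suc M)))))
        candidate-injective candidate-⊆ candidate-admissible)
      where
      length-parameters : length parameters ≡ (suc M ^ R) ^ d
      length-parameters = trans (length-vectors d (vectors R (range 0 (suc M))))
        (cong (_^ d) (trans (length-vectors R (range 0 (suc M))) (cong (_^ R) (length-range 0 (suc M)))))

f-corner-≥ : ∀ {n M K H′ d′} (v : Point (suc d′)) → (∀ j → lookup v j ≡ 1 ⊎ lookup v j ≡ n) →
  suc M * Roles.scale K (suc H′) ≤ n → suc M ^ (suc d′ * suc K * suc H′) ≤ f (suc K) (suc (suc H′)) (box n (suc d′)) v
f-corner-≥ {n} {M} {K} {H′} {d′} v v-corner [1+M]scale≤n = subst (_≤ f (suc K) (suc (suc H′)) (box n (suc d′)) v) (begin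
  (suc M ^ R) ^ suc d′              ≡⟨ ^-*-assoc (suc M) R (suc d′) ⟩
  suc M ^ (R * suc d′)              ≡⟨ cong (suc M ^_) (*-comm R (suc d′)) ⟩
  suc M ^ (suc d′ * R)              ≡⟨ cong (suc M ^_) (sym (*-assoc (suc d′) (suc K) (suc H′))) ⟩
  suc M ^ (suc d′ * suc K * suc H′) ∎)
  (Assembly.candidates-count n M K H′ d′ v v-corner (<-≤-trans (Gadget.top<scale n M K H′) [1+M]scale≤n))
  where
  open Roles K (suc H′) using (R)
  open ≡-Reasoning

lemma3p3 : (d k h : ℕ) → 1 ≤ d → 2 ≤ k → 2 ≤ h →
    Σ ℕ λ p → Σ ℕ λ q → 1 ≤ p × 1 ≤ q × Σ ℕ λ n₀ →
    (n : ℕ) → n₀ ≤ n → (v : Vec ℕ d) →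
    ((i : Fin d) → lookup v i ≡ 1 ⊎ lookup v i ≡ n) →
    p * n ^ (d * k * (h ∸ 1)) ≤ q * f k h (box n d) v
lemma3p3 (suc d′) (suc (suc K′)) (suc (suc H′)) (s≤s z≤n) (s≤s (s≤s z≤n)) (s≤s (s≤s z≤n)) =
  1 , (2 * scale) ^ E , ≤-refl , m^n>0 (2 * scale) E , scale , λ n scale≤n v v-corner →
  let (M , [1+M]scale≤n , n≤2scale[1+M]) = multiple-sandwich n scale scale≤n in begin
    1 * n ^ E                   ≡⟨ *-identityˡ (n ^ E) ⟩
    n ^ E                       ≤⟨ ^-monoˡ-≤ E n≤2scale[1+M] ⟩
    (2 * scale * suc M) ^ E     ≡⟨ ^-distribʳ-* (2 * scale) (suc M) E ⟩
    (2 * scale) ^ E * suc M ^ E ≤⟨ *-monoʳ-≤ ((2 * scale) ^ E) (f-corner-≥ {K = suc K′} {H′} v v-corner [1+M]scale≤n) ⟩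
    (2 * scale) ^ E * f (suc (suc K′)) (suc (suc H′)) (box n (suc d′)) v ∎
  where
  open Roles (suc K′) (suc H′) using (scale)
  open ≤-Reasoning
  E : ℕ
  E = suc d′ * suc (suc K′) * suc H′
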